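{- (1) $t(P_5)=t(C_5)=t(P_6)=t(C_6)=5$. (2) $t(P_7)=t(C_7)=t(P_8)=t(C_8)=t(P_9)=t(C_9)=t(P_{10})=6$.
   Context: $P_n$ and $C_n$ denote the path and the cycle on $n$ vertices. For a finite simple graph $G$, a $G$-CFF$(t,|V(G)|)$ is a family of subsets $B_v\subseteq[1,t]=\{1,\dots,t\}$, one for each vertex $v$, such that for every edge $\{a,b\}$: (i) $B_a\not\subseteq B_b$ and $B_b\not\subseteq B_a$, and (ii) for every vertex $w\notin\{a,b\}$, $B_w\not\subseteq B_a\cup B_b$. $t(G)$ is the minimum $t$ for which a $G$-CFF$(t,|V(G)|)$ exists. -}

module Defs where

open import Data.Nat using (ℕ; zero; suc; _≤_; _∸_; s≤s; z≤n; _+_)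
open import Data.Nat.Properties using (<-irrefl; n<1+n)
open import Data.Fin using (Fin; toℕ)
open import Data.Fin.Subset using (Subset; _⊆_; _∪_)
open import Data.Product using (Σ; _×_; _,_; ∃)
open import Data.Sum using (_⊎_; inj₁; inj₂)
open import Data.Empty using (⊥)
open import Relation.Nullary using (¬_)
open import Relation.Binary.PropositionalEquality using (_≡_; _≢_; trans; sym)

nn : ∀ m → m ≡ suc m → ⊥
nn m e = <-irrefl e (n<1+n m)

record SimpleGraph (n : ℕ) : Set₁ where
  field
    Adj     : Fin n → Fin n → Set
    symAdj  : ∀ {a b} → Adj a b → Adj b a
    irrefl  : ∀ {a} → ¬ Adj a a

pathAdj : (n : ℕ) → Fin n → Fin n → Set
pathAdj n i j = (toℕ j ≡ suc (toℕ i)) ⊎ (toℕ i ≡ suc (toℕ j))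

cycleAdj : (n : ℕ) → Fin n → Fin n → Set
cycleAdj n i j = pathAdj n i j
               ⊎ ((toℕ i ≡ 0 × toℕ j ≡ n ∸ 1) ⊎ (toℕ j ≡ 0 × toℕ i ≡ n ∸ 1))

P : (n : ℕ) → SimpleGraph n
P n = record { Adj = pathAdj n ; symAdj = sy ; irrefl = ir }
  where
  sy : ∀ {a b} → pathAdj n a b → pathAdj n b a
  sy (inj₁ e) = inj₂ e
  sy (inj₂ e) = inj₁ e
  ir : ∀ {a} → ¬ pathAdj n a a
  ir {a} (inj₁ e) = nn (toℕ a) e
  ir {a} (inj₂ e) = nn (toℕ a) e

zne : ∀ n → 3 ≤ n → 0 ≡ n ∸ 1 → ⊥
zne (suc (suc (suc _))) _ ()
zne (suc zero) (s≤s ()) _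

C : (n : ℕ) → 3 ≤ n → SimpleGraph n
C n 3≤n = record { Adj = cycleAdj n ; symAdj = sy ; irrefl = ir }
  where
  sy : ∀ {a b} → cycleAdj n a b → cycleAdj n b a
  sy (inj₁ (inj₁ e)) = inj₁ (inj₂ e)
  sy (inj₁ (inj₂ e)) = inj₁ (inj₁ e)
  sy (inj₂ (inj₁ e)) = inj₂ (inj₂ e)
  sy (inj₂ (inj₂ e)) = inj₂ (inj₁ e)
  bad : ∀ {a : Fin n} → toℕ a ≡ 0 → toℕ a ≡ n ∸ 1 → ⊥
  bad e1 e2 = zne n 3≤n (trans (sym e1) e2)
  ir : ∀ {a} → ¬ cycleAdj n a a
  ir {a} (inj₁ (inj₁ e)) = nn (toℕ a) e
  ir {a} (inj₁ (inj₂ e)) = nn (toℕ a) e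
  ir {a} (inj₂ (inj₁ (e1 , e2))) = bad {a} e1 e2
  ir {a} (inj₂ (inj₂ (e1 , e2))) = bad {a} e1 e2

-- A G-CFF(t, |V(G)|): a family of subsets B_v ⊆ [1,t] (here Fin t), one per vertex,
-- such that for every edge {a,b}: B_a ⊈ B_b, B_b ⊈ B_a, and for every w ∉ {a,b},
-- B_w ⊈ B_a ∪ B_b.
IsCFF : ∀ {n} → SimpleGraph n → (t : ℕ) → (Fin n → Subset t) → Set
IsCFF G t B = ∀ a b → Adj a b →
    (¬ (B a ⊆ B b)) × (¬ (B b ⊆ B a))
  × (∀ w → w ≢ a → w ≢ b → ¬ (B w ⊆ (B a ∪ B b)))
  where open SimpleGraph G

HasCFF : ∀ {n} → SimpleGraph n → ℕ → Set
HasCFF {n} G t = Σ (Fin n → Subset t) (IsCFF G t)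

tIs : ∀ {n} → SimpleGraph n → ℕ → Set
tIs G k = HasCFF G k × (∀ t → HasCFF G t → k ≤ t)

three≤ : ∀ m → 3 ≤ 3 + m
three≤ m = s≤s (s≤s (s≤s z≤n))

-- The upper bounds are explicit families, given on C_n whenever C_n has the same value; since
-- P_n is a spanning subgraph of C_n they serve P_n as well. For the lower bounds, a CFF of P_n
-- restricts to one of every subpath, and a CFF on t points extends to t + 1 points by a point
-- lying in no set. So it suffices that P_5 has no CFF on 4 points and P_7 none on 5. This is
-- checked by an exhaustive search that builds the family one vertex at a time and discards a
-- partial family as soon as its newest vertex violates a condition.
module Submission where

open import Defs
open import Data.Fin using (Fin; zero; suc; toℕ; _≟_; #_)
open import Data.Fin.Properties using (all?; suc-injective)
open import Data.Fin.Subset using (Subset; _⊆_; _∪_; ⊥; ⁅_⁆; inside; outside)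
open import Data.Fin.Subset.Properties using (_⊆?_; drop-∷-⊆)
open import Data.List using (List; []; _∷_; [_]; foldr; filter; cartesianProductWith)
open import Data.List.Membership.Propositional using (_∈_)
open import Data.List.Membership.Propositional.Properties
  using (∈-filter⁺; ∈-cartesianProductWith⁺; ∉[])
open import Data.List.Relation.Unary.Any using (here; there)
open import Data.Nat as ℕ using (ℕ; _+_; _≤_; _≤′_; ≤′-refl; ≤′-step; _≤?_)
open import Data.Nat.Properties using (≤⇒≤′; ≰⇒>)
open import Data.Product using (_×_; _,_; proj₂)
open import Data.Sum using (inj₁)
open import Data.Unit using (⊤; tt)
import Data.Sum as Sum
open import Data.Vec using (Vec; []; _∷_; lookup; tabulate)
import Data.Vec as Vec
open import Data.Vec.Relation.Unary.All using (All)
import Data.Vec.Relation.Unary.All as All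
open import Data.Vec.Relation.Unary.All.Properties using (lookup⁻)
open import Data.Vec.Properties using (lookup∘tabulate)
open import Function using (_∘_; id)
open import Relation.Binary.PropositionalEquality
  using (_≡_; refl; sym; cong; cong₂; subst; _≗_)
open import Relation.Nullary using (¬_; Dec; ¬?; yes; no; contradiction)
open import Relation.Nullary.Decidable using (True; toWitness; _×-dec_; _⊎-dec_; _→-dec_)

private
  variable
    n t u k : ℕ

module _ {G : SimpleGraph n} where
  open SimpleGraph G

  IsCFF-resp-≗ : ∀ {B B′ : Fin n → Subset t} → B ≗ B′ → IsCFF G t B → IsCFF G t B′
  IsCFF-resp-≗ B≗B′ cff a b ab =
    let a⊈b , b⊈a , uncovered = cff a b ab in
      resp (B≗B′ a) (B≗B′ b) a⊈b
    , resp (B≗B′ b) (B≗B′ a) b⊈a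
    , λ w w≢a w≢b → resp (B≗B′ w) (cong₂ _∪_ (B≗B′ a) (B≗B′ b)) (uncovered w w≢a w≢b)
    where
    resp : ∀ {x y x′ y′ : Subset t} → x ≡ x′ → y ≡ y′ → ¬ x ⊆ y → ¬ x′ ⊆ y′
    resp refl refl = id

  IsCFF-pad : ∀ {B : Fin n → Subset t} → IsCFF G t B → IsCFF G (ℕ.suc t) (λ v → outside ∷ B v)
  IsCFF-pad cff a b ab =
    let a⊈b , b⊈a , uncovered = cff a b ab in
      a⊈b ∘ drop-∷-⊆ , b⊈a ∘ drop-∷-⊆ , λ w w≢a w≢b → uncovered w w≢a w≢b ∘ drop-∷-⊆

  HasCFF-mono : t ≤ u → HasCFF G t → HasCFF G u
  HasCFF-mono = mono′ ∘ ≤⇒≤′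
    where
    mono′ : t ≤′ u → HasCFF G t → HasCFF G u
    mono′ ≤′-refl       cff       = cff
    mono′ (≤′-step t≤u) cff with B , isCFF ← mono′ t≤u cff = _ , IsCFF-pad isCFF

  HasCFF-lowerBound : ¬ HasCFF G k → ∀ t → HasCFF G t → ℕ.suc k ≤ t
  HasCFF-lowerBound {k} none t cff with t ≤? k
  ... | yes t≤k = contradiction (HasCFF-mono t≤k cff) none
  ... | no  t≰k = ≰⇒> t≰k

  IsCFF? : (∀ a b → Dec (Adj a b)) → ∀ t (B : Fin n → Subset t) → Dec (IsCFF G t B)
  IsCFF? Adj? t B = all? λ a → all? λ b → Adj? a b →-dec
    (¬? (B a ⊆? B b) ×-dec ¬? (B b ⊆? B a) ×-dec
      all? λ w → ¬? (w ≟ a) →-dec ¬? (w ≟ b) →-dec ¬? (B w ⊆? (B a ∪ B b)))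

IsCFF-subgraph : {G H : SimpleGraph n} {B : Fin n → Subset t} →
                 (∀ {a b} → SimpleGraph.Adj H a b → SimpleGraph.Adj G a b) →
                 IsCFF G t B → IsCFF H t B
IsCFF-subgraph H⊆G cff a b ab = cff a b (H⊆G ab)

HasCFF-C⇒P : ∀ (3≤n : 3 ≤ n) → HasCFF (C n 3≤n) t → HasCFF (P n) t
HasCFF-C⇒P 3≤n (B , cff) = B , IsCFF-subgraph {G = C _ 3≤n} {H = P _} inj₁ cff

pathAdj? : ∀ n (a b : Fin n) → Dec (pathAdj n a b)
pathAdj? n a b = (toℕ b ℕ.≟ ℕ.suc (toℕ a)) ⊎-dec (toℕ a ℕ.≟ ℕ.suc (toℕ b))

cycleAdj? : ∀ n (a b : Fin n) → Dec (cycleAdj n a b)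
cycleAdj? n a b = pathAdj? n a b ⊎-dec
  (((toℕ a ℕ.≟ 0) ×-dec (toℕ b ℕ.≟ n ℕ.∸ 1)) ⊎-dec ((toℕ b ℕ.≟ 0) ×-dec (toℕ a ℕ.≟ n ℕ.∸ 1)))

pathAdj-suc : ∀ {a b : Fin n} → pathAdj n a b → pathAdj (ℕ.suc n) (suc a) (suc b)
pathAdj-suc = Sum.map (cong ℕ.suc) (cong ℕ.suc)

IsCFF-P-tail : ∀ {B : Fin (ℕ.suc n) → Subset t} →
               IsCFF (P (ℕ.suc n)) t B → IsCFF (P n) t (B ∘ suc)
IsCFF-P-tail cff a b ab =
  let a⊈b , b⊈a , uncovered = cff (suc a) (suc b) (pathAdj-suc ab) in
  a⊈b , b⊈a , λ w w≢a w≢b → uncovered (suc w) (w≢a ∘ suc-injective) (w≢b ∘ suc-injective)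

HasCFF-P-drop : ∀ m → HasCFF (P (m + n)) t → HasCFF (P n) t
HasCFF-P-drop ℕ.zero    cff     = cff
HasCFF-P-drop (ℕ.suc m) (B , cff) = HasCFF-P-drop m (B ∘ suc , IsCFF-P-tail cff)

subsets : ∀ t → List (Subset t)
subsets ℕ.zero    = [ [] ]
subsets (ℕ.suc t) = cartesianProductWith Vec._∷_ (inside ∷ outside ∷ []) (subsets t)

∈-subsets : ∀ (s : Subset t) → s ∈ subsets t
∈-subsets []            = here refl
∈-subsets (inside ∷ s)  =
  ∈-cartesianProductWith⁺ Vec._∷_ {xs = inside ∷ outside ∷ []} (here refl) (∈-subsets s)
∈-subsets (outside ∷ s) =
  ∈-cartesianProductWith⁺ Vec._∷_ {xs = inside ∷ outside ∷ []} (there (here refl)) (∈-subsets s)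

Uncovered : Subset t → Vec (Subset t) n → Set
Uncovered v (a ∷ b ∷ ws) = ¬ v ⊆ (a ∪ b) × Uncovered v (b ∷ ws)
Uncovered v _            = ⊤

Uncovered? : ∀ (v : Subset t) (vs : Vec (Subset t) n) → Dec (Uncovered v vs)
Uncovered? v []           = yes tt
Uncovered? v (a ∷ [])     = yes tt
Uncovered? v (a ∷ b ∷ ws) = ¬? (v ⊆? (a ∪ b)) ×-dec Uncovered? v (b ∷ ws)

Uncovered-intro : ∀ v (vs : Vec (Subset t) n) →
                  (∀ a b → pathAdj n a b → ¬ v ⊆ (lookup vs a ∪ lookup vs b)) → Uncovered v vs
Uncovered-intro v []           _         = tt
Uncovered-intro v (a ∷ [])     _         = tt
Uncovered-intro v (a ∷ b ∷ ws) uncovered =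
  uncovered zero (suc zero) (inj₁ refl) ,
  Uncovered-intro v (b ∷ ws) (λ a b → uncovered (suc a) (suc b) ∘ pathAdj-suc)

-- The conditions of IsCFF for the path v ∷ u ∷ ws in which v takes part.
FrontConditions : Vec (Subset t) n → Set
FrontConditions (v ∷ u ∷ ws) =
  ¬ v ⊆ u × ¬ u ⊆ v × All (λ w → ¬ w ⊆ (v ∪ u)) ws × Uncovered v (u ∷ ws)
FrontConditions _ = ⊤

FrontConditions? : ∀ (vs : Vec (Subset t) n) → Dec (FrontConditions vs)
FrontConditions? []           = yes tt
FrontConditions? (v ∷ [])     = yes tt
FrontConditions? (v ∷ u ∷ ws) =
  ¬? (v ⊆? u) ×-dec ¬? (u ⊆? v) ×-dec All.all? (λ w → ¬? (w ⊆? (v ∪ u))) ws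
  ×-dec Uncovered? v (u ∷ ws)

IsCFF-P⇒FrontConditions : ∀ (vs : Vec (Subset t) n) → IsCFF (P n) t (lookup vs) →
                           FrontConditions vs
IsCFF-P⇒FrontConditions []           _   = tt
IsCFF-P⇒FrontConditions (v ∷ [])     _   = tt
IsCFF-P⇒FrontConditions (v ∷ u ∷ ws) cff =
  let v⊈u , u⊈v , v∪u-uncovered = cff zero (suc zero) (inj₁ refl) in
  v⊈u , u⊈v , lookup⁻ (λ i → v∪u-uncovered (suc (suc i)) (λ ()) (λ ())) ,
  Uncovered-intro v (u ∷ ws)
    (λ a b ab → proj₂ (proj₂ (cff (suc a) (suc b) (pathAdj-suc ab))) zero (λ ()) (λ ()))

-- Families grow at vertex 0, and the conditions not involving vertex 0 are conditions on the
-- tail, which were checked when the tail was listed.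
pathCFFCandidates : ∀ t k → List (Vec (Subset t) k)
pathCFFCandidates t ℕ.zero    = [ [] ]
pathCFFCandidates t (ℕ.suc k) =
  filter FrontConditions? (cartesianProductWith Vec._∷_ (subsets t) (pathCFFCandidates t k))

∈-pathCFFCandidates : ∀ (vs : Vec (Subset t) k) → IsCFF (P k) t (lookup vs) →
                      vs ∈ pathCFFCandidates t k
∈-pathCFFCandidates []         _   = here refl
∈-pathCFFCandidates (v ∷ vs) cff =
  ∈-filter⁺ FrontConditions?
    (∈-cartesianProductWith⁺ Vec._∷_ (∈-subsets v) (∈-pathCFFCandidates vs (IsCFF-P-tail cff)))
    (IsCFF-P⇒FrontConditions (v ∷ vs) cff)

noCandidates⇒¬HasCFF : pathCFFCandidates t k ≡ [] → ¬ HasCFF (P k) t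
noCandidates⇒¬HasCFF {t} {k} none (B , cff) = ∉[] (subst (tabulate B ∈_) none tabulate∈)
  where
  tabulate∈ : tabulate B ∈ pathCFFCandidates t k
  tabulate∈ =
    ∈-pathCFFCandidates (tabulate B) (IsCFF-resp-≗ {G = P k} (sym ∘ lookup∘tabulate B) cff)

P₅-noCFF₄ : ¬ HasCFF (P 5) 4
P₅-noCFF₄ = noCandidates⇒¬HasCFF refl

P₇-noCFF₅ : ¬ HasCFF (P 7) 5
P₇-noCFF₅ = noCandidates⇒¬HasCFF refl

P[m+5]-lowerBound : ∀ m t → HasCFF (P (m + 5)) t → 5 ≤ t
P[m+5]-lowerBound m t = HasCFF-lowerBound {G = P 5} P₅-noCFF₄ t ∘ HasCFF-P-drop m

P[m+7]-lowerBound : ∀ m t → HasCFF (P (m + 7)) t → 6 ≤ t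
P[m+7]-lowerBound m t = HasCFF-lowerBound {G = P 7} P₇-noCFF₅ t ∘ HasCFF-P-drop m

fromElements : List (Fin t) → Subset t
fromElements = foldr (λ i s → ⁅ i ⁆ ∪ s) ⊥

-- Each set is listed by its elements, and the points 1, …, t are numbered 0, …, t - 1.
family : Vec (List (Fin t)) n → Fin n → Subset t
family sets = fromElements ∘ lookup sets

HasCFF-byDecision : (G : SimpleGraph n) (Adj? : ∀ a b → Dec (SimpleGraph.Adj G a b))
                    (B : Fin n → Subset t) → {True (IsCFF? {G = G} Adj? t B)} → HasCFF G t
HasCFF-byDecision G Adj? B {ok} = B , toWitness ok

C₅-CFF : HasCFF (C 5 (three≤ 2)) 5
C₅-CFF = HasCFF-byDecision (C 5 (three≤ 2)) (cycleAdj? 5) (family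
  ( (# 3 ∷ # 4 ∷ []) ∷ (# 2 ∷ # 4 ∷ []) ∷ (# 1 ∷ # 4 ∷ []) ∷ (# 0 ∷ # 1 ∷ []) ∷ (# 0 ∷ # 3 ∷ [])
  ∷ []))

C₆-CFF : HasCFF (C 6 (three≤ 3)) 5
C₆-CFF = HasCFF-byDecision (C 6 (three≤ 3)) (cycleAdj? 6) (family
  ( (# 3 ∷ # 4 ∷ []) ∷ (# 2 ∷ # 4 ∷ []) ∷ (# 1 ∷ # 4 ∷ []) ∷ (# 0 ∷ # 1 ∷ []) ∷ (# 0 ∷ # 2 ∷ [])
  ∷ (# 0 ∷ # 3 ∷ [])
  ∷ []))

C₇-CFF : HasCFF (C 7 (three≤ 4)) 6
C₇-CFF = HasCFF-byDecision (C 7 (three≤ 4)) (cycleAdj? 7) (family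
  ( (# 3 ∷ # 4 ∷ # 5 ∷ []) ∷ (# 2 ∷ # 4 ∷ # 5 ∷ []) ∷ (# 1 ∷ # 4 ∷ # 5 ∷ [])
  ∷ (# 0 ∷ # 1 ∷ # 5 ∷ []) ∷ (# 1 ∷ # 3 ∷ # 5 ∷ []) ∷ (# 1 ∷ # 2 ∷ # 3 ∷ [])
  ∷ (# 0 ∷ # 3 ∷ # 4 ∷ [])
  ∷ []))

C₈-CFF : HasCFF (C 8 (three≤ 5)) 6
C₈-CFF = HasCFF-byDecision (C 8 (three≤ 5)) (cycleAdj? 8) (family
  ( (# 3 ∷ # 4 ∷ # 5 ∷ []) ∷ (# 2 ∷ # 4 ∷ # 5 ∷ []) ∷ (# 1 ∷ # 4 ∷ # 5 ∷ [])
  ∷ (# 0 ∷ # 1 ∷ # 5 ∷ []) ∷ (# 1 ∷ # 3 ∷ # 5 ∷ []) ∷ (# 1 ∷ # 2 ∷ # 3 ∷ [])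
  ∷ (# 1 ∷ # 3 ∷ # 4 ∷ []) ∷ (# 0 ∷ # 3 ∷ # 4 ∷ [])
  ∷ []))

C₉-CFF : HasCFF (C 9 (three≤ 6)) 6
C₉-CFF = HasCFF-byDecision (C 9 (three≤ 6)) (cycleAdj? 9) (family
  ( (# 3 ∷ # 4 ∷ # 5 ∷ []) ∷ (# 2 ∷ # 4 ∷ # 5 ∷ []) ∷ (# 1 ∷ # 4 ∷ # 5 ∷ [])
  ∷ (# 0 ∷ # 1 ∷ # 5 ∷ []) ∷ (# 1 ∷ # 3 ∷ # 5 ∷ []) ∷ (# 1 ∷ # 2 ∷ # 3 ∷ [])
  ∷ (# 0 ∷ # 1 ∷ # 2 ∷ []) ∷ (# 0 ∷ # 2 ∷ # 4 ∷ []) ∷ (# 0 ∷ # 3 ∷ # 4 ∷ [])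
  ∷ []))

P₁₀-CFF : HasCFF (P 10) 6
P₁₀-CFF = HasCFF-byDecision (P 10) (pathAdj? 10) (family
  ( (# 3 ∷ # 4 ∷ # 5 ∷ []) ∷ (# 2 ∷ # 4 ∷ # 5 ∷ []) ∷ (# 1 ∷ # 4 ∷ # 5 ∷ [])
  ∷ (# 0 ∷ # 1 ∷ # 5 ∷ []) ∷ (# 1 ∷ # 3 ∷ # 5 ∷ []) ∷ (# 1 ∷ # 2 ∷ # 3 ∷ [])
  ∷ (# 1 ∷ # 3 ∷ # 4 ∷ []) ∷ (# 0 ∷ # 3 ∷ # 4 ∷ []) ∷ (# 0 ∷ # 2 ∷ # 4 ∷ [])
  ∷ (# 0 ∷ # 1 ∷ # 2 ∷ [])
  ∷ []))

tIs-P-C : ∀ (3≤n : 3 ≤ n) → HasCFF (C n 3≤n) k → (∀ t → HasCFF (P n) t → k ≤ t) →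
          tIs (P n) k × tIs (C n 3≤n) k
tIs-P-C 3≤n cff lowerBound =
  (HasCFF-C⇒P 3≤n cff , lowerBound) , (cff , λ t → lowerBound t ∘ HasCFF-C⇒P 3≤n)

theorem8p5 : (tIs (P 5) 5 × tIs (C 5 (three≤ 2)) 5 × tIs (P 6) 5 × tIs (C 6 (three≤ 3)) 5)
    × (tIs (P 7) 6 × tIs (C 7 (three≤ 4)) 6 × tIs (P 8) 6 × tIs (C 8 (three≤ 5)) 6
       × tIs (P 9) 6 × tIs (C 9 (three≤ 6)) 6 × tIs (P 10) 6)
theorem8p5 =
  let p₅ , c₅ = tIs-P-C (three≤ 2) C₅-CFF (P[m+5]-lowerBound 0)
      p₆ , c₆ = tIs-P-C (three≤ 3) C₆-CFF (P[m+5]-lowerBound 1)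
      p₇ , c₇ = tIs-P-C (three≤ 4) C₇-CFF (P[m+7]-lowerBound 0)
      p₈ , c₈ = tIs-P-C (three≤ 5) C₈-CFF (P[m+7]-lowerBound 1)
      p₉ , c₉ = tIs-P-C (three≤ 6) C₉-CFF (P[m+7]-lowerBound 2)
      p₁₀     = P₁₀-CFF , P[m+7]-lowerBound 3
  in (p₅ , c₅ , p₆ , c₆) , (p₇ , c₇ , p₈ , c₈ , p₉ , c₉ , p₁₀)
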